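{- Let $P=\{S_1,\ldots,S_n\}$ be a homothetic packing of $n$ squares with radii $r_1,\ldots,r_n$ and centres $p_1,\ldots,p_n$, and let $1\le s\le n-1$. Suppose that (i) $\sum_{i=1}^s r_i=\sum_{i=s+1}^n r_i$; (ii) $p_1=(r_1,r_1)$ and $p_{s+1}=(r_{s+1},-r_{s+1})$; (iii) $p_i=\big(r_i+\sum_{j=1}^{i-1}2r_j,\; r_i\big)$ for all $2\le i\le s$, and $p_i=\big(r_i+\sum_{j=s+1}^{i-1}2r_j,\; -r_i\big)$ for all $s+2\le i\le n$. Then the graph $([n],E_y)$ is connected.
   Context: Let $S=[-1,1]^2\subset\mathbb{R}^2$. A homothetic packing of $n$ squares is a set $\{S_1,\ldots,S_n\}$ with $S_i=r_iS+p_i$ ($r_i>0$, $p_i=(x_i,y_i)\in\mathbb{R}^2$) whose members have pairwise disjoint interiors. Its contact graph $G=([n],E)$ has $\{i,j\}\in E$ iff $i\ne j$ and $S_i\cap S_j\neq\emptyset$; $E_y\subseteq E$ is the set of edges $\{i,j\}$ with $r_i+r_j=|y_i-y_j|\ge|x_i-x_j|$. -}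

module Defs where

open import Level using (0ℓ)
open import Data.Nat using (ℕ; zero; suc) renaming (_+_ to _+ℕ_; _≤_ to _≤ℕ_)
open import Data.Product using (Σ; ∃; _×_; _,_; proj₁; proj₂)
open import Data.Sum using (_⊎_)
open import Relation.Nullary using (¬_)
open import Relation.Binary using (tri<; tri≈; tri>)
open import Relation.Binary.Structures using (IsStrictTotalOrder)
open import Relation.Binary.PropositionalEquality using (_≡_; _≢_)
open import Relation.Binary.Construct.Closure.ReflexiveTransitive using (Star)
open import Algebra.Structures using (IsCommutativeRing)

-- The real numbers, axiomatised as a complete ordered field
-- (any two models are isomorphic, so this is exactly ℝ).
record RealField : Set₁ where
  infixl 6 _+_ _-_
  infixl 7 _*_
  infix 4 _<_ _≤_
  field
    ℝ : Set
    _+_ _*_ : ℝ → ℝ → ℝ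
    -_ : ℝ → ℝ
    0# 1# : ℝ
    _<_ : ℝ → ℝ → Set
    isCommutativeRing : IsCommutativeRing _≡_ _+_ _*_ -_ 0# 1#
    0≢1 : 0# ≢ 1#
    inverse : ∀ x → x ≢ 0# → ∃ λ y → x * y ≡ 1#
    isStrictTotalOrder : IsStrictTotalOrder _≡_ _<_
    +-mono-< : ∀ {x y} z → x < y → x + z < y + z
    *-pos : ∀ {x y} → 0# < x → 0# < y → 0# < x * y

  _≤_ : ℝ → ℝ → Set
  x ≤ y = x < y ⊎ x ≡ y

  _-_ : ℝ → ℝ → ℝ
  x - y = x + (- y)

  field
    complete : (A : ℝ → Set) → ∃ A → (∃ λ b → ∀ a → A a → a ≤ b) →
               ∃ λ s → (∀ a → A a → a ≤ s) × (∀ b → (∀ a → A a → a ≤ b) → s ≤ b)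

  open IsStrictTotalOrder isStrictTotalOrder using (compare)

  ∣_∣ : ℝ → ℝ
  ∣ x ∣ with compare x 0#
  ... | tri< _ _ _ = - x
  ... | tri≈ _ _ _ = x
  ... | tri> _ _ _ = x

  sumFrom : (ℕ → ℝ) → ℕ → ℕ → ℝ
  sumFrom f m zero    = 0#
  sumFrom f m (suc k) = sumFrom f m k + f (m +ℕ k)

  Point : Set
  Point = ℝ × ℝ

  -- z lies in the closed square r S + p, S = [-1,1]^2
  InSquare : ℝ → Point → Point → Set
  InSquare r p z = ∣ proj₁ z - proj₁ p ∣ ≤ r × ∣ proj₂ z - proj₂ p ∣ ≤ r

  InInterior : ℝ → Point → Point → Set
  InInterior r p z = ∣ proj₁ z - proj₁ p ∣ < r × ∣ proj₂ z - proj₂ p ∣ < r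

  InRange : ℕ → ℕ → Set
  InRange n i = 1 ≤ℕ i × i ≤ℕ n

  IsPacking : ℕ → (ℕ → ℝ) → (ℕ → Point) → Set
  IsPacking n r p =
    (∀ i → InRange n i → 0# < r i) ×
    (∀ i j → InRange n i → InRange n j → i ≢ j →
      ¬ (∃ λ z → InInterior (r i) (p i) z × InInterior (r j) (p j) z))

  ContactEdge : (ℕ → ℝ) → (ℕ → Point) → ℕ → ℕ → Set
  ContactEdge r p i j = i ≢ j × (∃ λ z → InSquare (r i) (p i) z × InSquare (r j) (p j) z)

  EyEdge : (ℕ → ℝ) → (ℕ → Point) → ℕ → ℕ → Set
  EyEdge r p i j =
    ContactEdge r p i j ×
    (r i + r j ≡ ∣ proj₂ (p i) - proj₂ (p j) ∣) ×
    (∣ proj₁ (p i) - proj₁ (p j) ∣ ≤ r i + r j)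

  EyConnected : ℕ → (ℕ → ℝ) → (ℕ → Point) → Set
  EyConnected n r p =
    ∀ i j → InRange n i → InRange n j →
      Star (λ a b → InRange n a × InRange n b × EyEdge r p a b) i j

-- The top squares S₁ … S_s sit side by side on the x-axis, so their projections to the x-axis
-- are consecutive intervals [Aₖ, Aₖ₊₁] tiling [0, T]; the bottom squares hang below the axis and,
-- by (i), their projections [Bₗ, Bₗ₊₁] tile the same [0, T]. A top and a bottom square whose
-- intervals meet share a point of the x-axis and form an edge of E_y. Two consecutive top squares
-- are both adjacent to the bottom square under their common corner, and each bottom square is
-- adjacent to the top square above its left corner, so every square is joined to S₁.
module Submission where

open import Defs
open import Data.Nat using (ℕ; zero; suc; _∸_; z≤n; s≤s)
  renaming (_+_ to _+ℕ_; _≤_ to _≤ℕ_)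
import Data.Nat.Properties as ℕ
open import Data.Product using (_×_; _,_; proj₂; ∃; ∃-syntax)
open import Data.Sum using (_⊎_; inj₁; inj₂)
open import Data.Empty using (⊥-elim)
open import Function using (_∘_)
open import Relation.Nullary using (yes; no)
open import Relation.Binary using (Rel; Symmetric; tri<; tri≈; tri>)
open import Relation.Binary.Structures using (IsTotalPreorder; IsStrictTotalOrder; IsTotalOrder)
open import Relation.Binary.PropositionalEquality
open import Relation.Binary.Construct.Closure.ReflexiveTransitive using (Star; ε; _◅_; _◅◅_; reverse)
import Relation.Binary.Construct.StrictToNonStrict as StrictToNonStrict
open import Algebra.Bundles using (CommutativeRing)
import Algebra.Solver.CommutativeMonoid as CommutativeMonoidSolver
import Algebra.Properties.AbelianGroup as AbelianGroupProperties

module Interleaving {a ℓ} {X : Set a} {_≤_ : Rel X ℓ}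
                    (isTotalPreorder : IsTotalPreorder _≡_ _≤_) where
  open IsTotalPreorder isTotalPreorder using (total) renaming (refl to ≤-refl; trans to ≤-trans)

  sequence-mono : (g : ℕ → X) (K : ℕ) → (∀ k → k ≤ℕ K → g k ≤ g (suc k)) →
                  ∀ {i j} → i ≤ℕ j → j ≤ℕ suc K → g i ≤ g j
  sequence-mono g K step {j = zero} z≤n _ = ≤-refl
  sequence-mono g K step {i} {suc j} i≤1+j (s≤s j≤K) with ℕ.m≤n⇒m<n∨m≡n i≤1+j
  ... | inj₂ refl      = ≤-refl
  ... | inj₁ (s≤s i≤j) = ≤-trans (sequence-mono g K step i≤j (ℕ.m≤n⇒m≤1+n j≤K)) (step j j≤K)

  between-ends : (g : ℕ → X) (K : ℕ) → (∀ k → k ≤ℕ K → g k ≤ g (suc k)) →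
                 ∀ {k} → k ≤ℕ suc K → g 0 ≤ g k × g k ≤ g (suc K)
  between-ends g K step k≤1+K =
    sequence-mono g K step z≤n k≤1+K , sequence-mono g K step k≤1+K ℕ.≤-refl

  interval-cover : (b : ℕ → X) {x : X} (L : ℕ) → b 0 ≤ x → x ≤ b (suc L) →
                   ∃[ l ] l ≤ℕ L × b l ≤ x × x ≤ b (suc l)
  interval-cover b zero b₀≤x x≤b₁ = 0 , z≤n , b₀≤x , x≤b₁
  interval-cover b {x} (suc L) b₀≤x x≤b with total x (b (suc L))
  ... | inj₁ x≤bL = let l , l≤L , bₗ≤x≤bₗ₊₁ = interval-cover b L b₀≤x x≤bL in
                    l , ℕ.m≤n⇒m≤1+n l≤L , bₗ≤x≤bₗ₊₁
  ... | inj₂ bL≤x = suc L , ℕ.≤-refl , bL≤x , x≤b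

  module TwoRows {v ℓ′} {V : Set v} (_~_ : Rel V ℓ′) (~-sym : Symmetric _~_)
                 (top bot : ℕ → V) (a b : ℕ → X) (K L : ℕ)
                 (a-step : ∀ k → k ≤ℕ K → a k ≤ a (suc k))
                 (b-step : ∀ l → l ≤ℕ L → b l ≤ b (suc l))
                 (same-start : a 0 ≡ b 0) (same-end : a (suc K) ≡ b (suc L))
                 (overlap⇒adjacent : ∀ k l → k ≤ℕ K → l ≤ℕ L →
                                     a k ≤ b (suc l) → b l ≤ a (suc k) → top k ~ bot l)
                 where

    top-reachable : ∀ k → k ≤ℕ K → Star _~_ (top 0) (top k)
    top-reachable zero    _     = ε
    top-reachable (suc k) 1+k≤K with between-ends a K a-step (s≤s (ℕ.<⇒≤ 1+k≤K))
    ... | a₀≤x , x≤end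
      with interval-cover b L (subst (_≤ _) same-start a₀≤x) (subst (_ ≤_) same-end x≤end)
    ... | l , l≤L , bₗ≤x , x≤bₗ₊₁ =
      top-reachable k k≤K ◅◅ top-k~bot-l ◅ ~-sym top-1+k~bot-l ◅ ε
      where
      k≤K = ℕ.<⇒≤ 1+k≤K
      top-k~bot-l = overlap⇒adjacent k l k≤K l≤L (≤-trans (a-step k k≤K) x≤bₗ₊₁) bₗ≤x
      top-1+k~bot-l = overlap⇒adjacent (suc k) l 1+k≤K l≤L x≤bₗ₊₁
                                       (≤-trans bₗ≤x (a-step (suc k) 1+k≤K))

    bot-reachable : ∀ l → l ≤ℕ L → Star _~_ (top 0) (bot l)
    bot-reachable l l≤L with between-ends b L b-step (ℕ.m≤n⇒m≤1+n l≤L)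
    ... | b₀≤x , x≤end
      with interval-cover a K (subst (_≤ _) (sym same-start) b₀≤x) (subst (_ ≤_) (sym same-end) x≤end)
    ... | k , k≤K , aₖ≤x , x≤aₖ₊₁ =
      top-reachable k k≤K ◅◅ overlap⇒adjacent k l k≤K l≤L (≤-trans aₖ≤x (b-step l l≤L)) x≤aₖ₊₁ ◅ ε

module RealFieldProperties (R : RealField) where
  open RealField R

  commutativeRing : CommutativeRing _ _
  commutativeRing = record { isCommutativeRing = isCommutativeRing }

  open CommutativeRing commutativeRing
    using (+-comm; +-identityˡ; +-identityʳ; -‿inverseˡ; -‿inverseʳ; +-abelianGroup; +-commutativeMonoid)
  open CommutativeMonoidSolver +-commutativeMonoid using (solve; _⊜_; _⊕_)
  open AbelianGroupProperties +-abelianGroup using (⁻¹-anti-homo‿-; ⁻¹-involutive; ε⁻¹≈ε)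
  open IsStrictTotalOrder isStrictTotalOrder
    using (compare) renaming (trans to <-trans; irrefl to <-irrefl)

  ≤-isTotalOrder : IsTotalOrder _≡_ _≤_
  ≤-isTotalOrder = StrictToNonStrict.isTotalOrder _≡_ _<_ isStrictTotalOrder

  open IsTotalOrder ≤-isTotalOrder public
    using (isTotalPreorder; total) renaming (refl to ≤-refl; trans to ≤-trans)

  <-≤-trans : ∀ {x y z} → x < y → y ≤ z → x < z
  <-≤-trans = StrictToNonStrict.<-≤-trans _≡_ _<_ <-trans (subst _)

  +-monoʳ-< : ∀ {x y} z → x < y → z + x < z + y
  +-monoʳ-< {x} {y} z x<y = subst₂ _<_ (+-comm x z) (+-comm y z) (+-mono-< z x<y)

  +-monoʳ-≤ : ∀ {x y} z → x ≤ y → z + x ≤ z + y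
  +-monoʳ-≤ z (inj₁ x<y)  = inj₁ (+-monoʳ-< z x<y)
  +-monoʳ-≤ z (inj₂ refl) = inj₂ refl

  +-monoˡ-≤ : ∀ {x y} z → x ≤ y → x + z ≤ y + z
  +-monoˡ-≤ z (inj₁ x<y)  = inj₁ (+-mono-< z x<y)
  +-monoˡ-≤ z (inj₂ refl) = inj₂ refl

  +-pos : ∀ {x y} → 0# < x → 0# < y → 0# < x + y
  +-pos {x} {y} 0<x 0<y = <-trans 0<y (subst (_< x + y) (+-identityˡ y) (+-mono-< y 0<x))

  x≤x+y : ∀ {x y} → 0# ≤ y → x ≤ x + y
  x≤x+y {x} {y} 0≤y = subst (_≤ x + y) (+-identityʳ x) (+-monoʳ-≤ x 0≤y)

  neg-pos : ∀ {x} → 0# < x → - x < 0#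
  neg-pos {x} 0<x = subst₂ _<_ (+-identityˡ (- x)) (-‿inverseʳ x) (+-mono-< (- x) 0<x)

  neg-neg : ∀ {x} → x < 0# → 0# < - x
  neg-neg {x} x<0 = subst₂ _<_ (-‿inverseʳ x) (+-identityˡ (- x)) (+-mono-< (- x) x<0)

  x-y≤z : ∀ {x y z} → x ≤ y + z → x - y ≤ z
  x-y≤z {x} {y} {z} x≤y+z = subst (x - y ≤_) y+z-y≡z (+-monoˡ-≤ (- y) x≤y+z)
    where
    y+z-y≡z : (y + z) - y ≡ z
    y+z-y≡z = trans (solve 3 (λ y z w → (y ⊕ z) ⊕ w ⊜ z ⊕ (y ⊕ w)) refl y z (- y))
                    (trans (cong (z +_) (-‿inverseʳ y)) (+-identityʳ z))

  ∣x∣≡x : ∀ {x} → 0# ≤ x → ∣ x ∣ ≡ x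
  ∣x∣≡x {x} 0≤x with compare x 0#
  ... | tri< x<0 _ _ = ⊥-elim (<-irrefl refl (<-≤-trans x<0 0≤x))
  ... | tri≈ _ _ _   = refl
  ... | tri> _ _ _   = refl

  ∣x∣≡-x : ∀ {x} → x < 0# → ∣ x ∣ ≡ - x
  ∣x∣≡-x {x} x<0 with compare x 0#
  ... | tri< _ _ _   = refl
  ... | tri≈ _ x≡0 _ = ⊥-elim (<-irrefl x≡0 x<0)
  ... | tri> _ _ 0<x = ⊥-elim (<-irrefl refl (<-trans x<0 0<x))

  ∣-x∣≡∣x∣ : ∀ x → ∣ - x ∣ ≡ ∣ x ∣
  ∣-x∣≡∣x∣ x with compare x 0#
  ... | tri< x<0 _ _  = ∣x∣≡x (inj₁ (neg-neg x<0))
  ... | tri≈ _ refl _ = trans (cong ∣_∣ ε⁻¹≈ε) (∣x∣≡x (inj₂ refl))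
  ... | tri> _ _ 0<x  = trans (∣x∣≡-x (neg-pos 0<x)) (⁻¹-involutive x)

  ∣x-y∣≡∣y-x∣ : ∀ x y → ∣ x - y ∣ ≡ ∣ y - x ∣
  ∣x-y∣≡∣y-x∣ x y = trans (sym (∣-x∣≡∣x∣ (x - y))) (cong ∣_∣ (⁻¹-anti-homo‿- x y))

  ∣x∣≤ : ∀ {x m} → x ≤ m → - x ≤ m → ∣ x ∣ ≤ m
  ∣x∣≤ {x} x≤m -x≤m with compare x 0#
  ... | tri< _ _ _ = -x≤m
  ... | tri≈ _ _ _ = x≤m
  ... | tri> _ _ _ = x≤m

  ∣x-y∣≤ : ∀ {x y m} → x ≤ y + m → y ≤ x + m → ∣ x - y ∣ ≤ m
  ∣x-y∣≤ {x} {y} x≤y+m y≤x+m =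
    ∣x∣≤ (x-y≤z x≤y+m) (subst (_≤ _) (sym (⁻¹-anti-homo‿- x y)) (x-y≤z y≤x+m))

  common-point : ∀ {a c d e} → 0# ≤ d → 0# ≤ e → a ≤ c + d → c ≤ a + e →
                 ∃ λ x → (a ≤ x × x ≤ a + e) × (c ≤ x × x ≤ c + d)
  common-point {a} {c} 0≤d 0≤e a≤c+d c≤a+e with total a c
  ... | inj₁ a≤c = c , (a≤c , c≤a+e) , (≤-refl , x≤x+y 0≤d)
  ... | inj₂ c≤a = a , (≤-refl , x≤x+y 0≤e) , (c≤a , a≤c+d)

  ∣x-centre∣≤radius : ∀ {a x ρ} → a ≤ x → x ≤ a + (ρ + ρ) → ∣ x - (ρ + a) ∣ ≤ ρ
  ∣x-centre∣≤radius {a} {x} {ρ} a≤x x≤a+2ρ =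
    ∣x-y∣≤ (subst (x ≤_) (solve 2 (λ a ρ → a ⊕ (ρ ⊕ ρ) ⊜ (ρ ⊕ a) ⊕ ρ) refl a ρ) x≤a+2ρ)
           (subst (ρ + a ≤_) (+-comm ρ x) (+-monoʳ-≤ ρ a≤x))

  EyEdge-sym : ∀ {r p i j} → EyEdge r p i j → EyEdge r p j i
  EyEdge-sym {r} {p} {i} {j} ((i≢j , z , z∈Sᵢ , z∈Sⱼ) , vertical , horizontal) =
      (i≢j ∘ sym , z , z∈Sⱼ , z∈Sᵢ)
    , trans (+-comm (r j) (r i)) (trans vertical (∣x-y∣≡∣y-x∣ _ _))
    , subst₂ _≤_ (∣x-y∣≡∣y-x∣ _ _) (+-comm (r i) (r j)) horizontal

  -- A square resting on the x-axis over [a, a + 2rₜ] and one hanging below it over [c, c + 2r_b].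
  facing-squares-EyEdge : ∀ (r : ℕ → ℝ) (p : ℕ → Point) {t b a c} →
    t ≢ b → 0# < r t → 0# < r b →
    p t ≡ (r t + a , r t) → p b ≡ (r b + c , - r b) →
    a ≤ c + (r b + r b) → c ≤ a + (r t + r t) → EyEdge r p t b
  facing-squares-EyEdge r p {t} {b} {a} {c} t≢b 0<rₜ 0<r_b pₜ p_b a≤c+2r_b c≤a+2rₜ
    rewrite pₜ | p_b
    with common-point (inj₁ (+-pos 0<r_b 0<r_b)) (inj₁ (+-pos 0<rₜ 0<rₜ)) a≤c+2r_b c≤a+2rₜ
  ... | x , (a≤x , x≤a+2rₜ) , (c≤x , x≤c+2r_b) =
      (t≢b , (x , 0#) , (∣x-centre∣≤radius a≤x x≤a+2rₜ , on-top-base)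
                      , (∣x-centre∣≤radius c≤x x≤c+2r_b , on-bottom-base))
    , vertical , horizontal
    where
    on-top-base : ∣ 0# - r t ∣ ≤ r t
    on-top-base = ∣x-y∣≤ (inj₁ (+-pos 0<rₜ 0<rₜ)) (inj₂ (sym (+-identityˡ (r t))))
    on-bottom-base : ∣ 0# - (- r b) ∣ ≤ r b
    on-bottom-base = ∣x-y∣≤ (inj₂ (sym (-‿inverseˡ (r b))))
                            (inj₁ (<-trans (neg-pos 0<r_b) (subst (0# <_) (sym (+-identityˡ (r b))) 0<r_b)))
    vertical : r t + r b ≡ ∣ r t - (- r b) ∣
    vertical = sym (begin
      ∣ r t - (- r b) ∣ ≡⟨ cong (λ y → ∣ r t + y ∣) (⁻¹-involutive (r b)) ⟩
      ∣ r t + r b ∣     ≡⟨ ∣x∣≡x (inj₁ (+-pos 0<rₜ 0<r_b)) ⟩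
      r t + r b         ∎)
      where open ≡-Reasoning
    horizontal : ∣ (r t + a) - (r b + c) ∣ ≤ r t + r b
    horizontal = ∣x-y∣≤ (subst (r t + a ≤_) top-shift (+-monoʳ-≤ (r t) a≤c+2r_b))
                        (subst (r b + c ≤_) bottom-shift (+-monoʳ-≤ (r b) c≤a+2rₜ))
      where
      top-shift : r t + (c + (r b + r b)) ≡ (r b + c) + (r t + r b)
      top-shift = solve 3 (λ rₜ c r_b → rₜ ⊕ (c ⊕ (r_b ⊕ r_b)) ⊜ (r_b ⊕ c) ⊕ (rₜ ⊕ r_b))
                          refl (r t) c (r b)
      bottom-shift : r b + (a + (r t + r t)) ≡ (r t + a) + (r t + r b)
      bottom-shift = solve 3 (λ rₜ a r_b → r_b ⊕ (a ⊕ (rₜ ⊕ rₜ)) ⊜ (rₜ ⊕ a) ⊕ (rₜ ⊕ r_b))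
                             refl (r t) a (r b)

  sumFrom-+ : ∀ f g m k → sumFrom (λ j → f j + g j) m k ≡ sumFrom f m k + sumFrom g m k
  sumFrom-+ f g m zero    = sym (+-identityʳ 0#)
  sumFrom-+ f g m (suc k) rewrite sumFrom-+ f g m k =
    solve 4 (λ F G x y → (F ⊕ G) ⊕ (x ⊕ y) ⊜ (F ⊕ x) ⊕ (G ⊕ y)) refl
            (sumFrom f m k) (sumFrom g m k) (f (m +ℕ k)) (g (m +ℕ k))

-- The top row is S₁ … S_s, the bottom row S_{s+1} … S_n, with s = suc s' and n - s = suc N'.
module SquareRows (R : RealField) (r : ℕ → RealField.ℝ R) (p : ℕ → RealField.Point R) (s' N' : ℕ)
                  where
  open RealField R
  open RealFieldProperties R
  open CommutativeRing commutativeRing using (+-identityʳ)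

  n : ℕ
  n = suc s' +ℕ suc N'

  top bot : ℕ → ℕ
  top k = suc k
  bot l = suc (suc s') +ℕ l

  width : ℕ → ℝ
  width j = r j + r j

  A B : ℕ → ℝ
  A = sumFrom width 1
  B = sumFrom width (suc (suc s'))

  top-in-range : ∀ {k} → k ≤ℕ s' → InRange n (top k)
  top-in-range k≤s' = s≤s z≤n , s≤s (ℕ.≤-trans k≤s' (ℕ.m≤m+n s' (suc N')))

  bot-in-range : ∀ {l} → l ≤ℕ N' → InRange n (bot l)
  bot-in-range {l} l≤N' =
    s≤s z≤n , s≤s (subst (suc s' +ℕ l ≤ℕ_) (sym (ℕ.+-suc s' N')) (s≤s (ℕ.+-monoʳ-≤ s' l≤N')))

  top≢bot : ∀ {k l} → k ≤ℕ s' → top k ≢ bot l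
  top≢bot {l = l} k≤s' = ℕ.<⇒≢ (s≤s (s≤s (ℕ.≤-trans k≤s' (ℕ.m≤m+n s' l))))

  in-range⇒row : ∀ {i} → InRange n i →
                 (∃[ k ] k ≤ℕ s' × i ≡ top k) ⊎ (∃[ l ] l ≤ℕ N' × i ≡ bot l)
  in-range⇒row {suc k} (_ , 1+k≤n) with k ℕ.≤? s'
  ... | yes k≤s' = inj₁ (k , k≤s' , refl)
  ... | no  k≰s' = inj₂ (k ∸ suc s' , l≤N' , cong suc (sym (ℕ.m+[n∸m]≡n (ℕ.≰⇒> k≰s'))))
    where
    l≤N' : k ∸ suc s' ≤ℕ N'
    l≤N' = ℕ.m≤n+o⇒m∸n≤o k (suc s') (subst (k ≤ℕ_) (ℕ.+-suc s' N') (ℕ.≤-pred 1+k≤n))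

  _~_ : Rel ℕ _
  i ~ j = InRange n i × InRange n j × EyEdge r p i j

  ~-sym : Symmetric _~_
  ~-sym (i∈ , j∈ , i-j) = j∈ , i∈ , EyEdge-sym i-j

  top-centres : p 1 ≡ (r 1 , r 1) →
    (∀ i → 2 ≤ℕ i → i ≤ℕ suc s' → p i ≡ (r i + A (i ∸ 1) , r i)) →
    ∀ k → k ≤ℕ s' → p (top k) ≡ (r (top k) + A k , r (top k))
  top-centres p₁ pᵢ zero    _    = trans p₁ (cong (_, r 1) (sym (+-identityʳ (r 1))))
  top-centres p₁ pᵢ (suc k) k<s' = pᵢ (suc (suc k)) (s≤s (s≤s z≤n)) (s≤s k<s')

  bot-centres : p (suc (suc s')) ≡ (r (suc (suc s')) , - r (suc (suc s'))) →
    (∀ i → suc s' +ℕ 2 ≤ℕ i → i ≤ℕ n →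
      p i ≡ (r i + B (i ∸ suc (suc s')) , - r i)) →
    ∀ l → l ≤ℕ N' → p (bot l) ≡ (r (bot l) + B l , - r (bot l))
  bot-centres pₛ₊₁ pᵢ zero _ rewrite ℕ.+-identityʳ (suc (suc s')) =
    trans pₛ₊₁ (cong (_, _) (sym (+-identityʳ _)))
  bot-centres pₛ₊₁ pᵢ (suc l) 1+l≤N' with pᵢ (bot (suc l)) s+2≤i (proj₂ (bot-in-range 1+l≤N'))
    where
    s+2≤i : suc s' +ℕ 2 ≤ℕ bot (suc l)
    s+2≤i = subst (_≤ℕ bot (suc l)) (sym (ℕ.+-suc (suc s') 1)) (ℕ.+-monoʳ-≤ (suc (suc s')) (s≤s z≤n))
  ... | pᵢ-bot rewrite ℕ.m+n∸m≡n (suc (suc s')) (suc l) = pᵢ-bot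

  equal-widths : sumFrom r 1 (suc s') ≡ sumFrom r (suc (suc s')) (n ∸ suc s') → A (suc s') ≡ B (suc N')
  equal-widths same-radius-sum = begin
    A (suc s')                    ≡⟨ sumFrom-+ r r 1 (suc s') ⟩
    top-sum + top-sum             ≡⟨ cong (λ x → x + x) top-sum≡bot-sum ⟩
    bot-sum + bot-sum             ≡⟨ sym (sumFrom-+ r r (suc (suc s')) (suc N')) ⟩
    B (suc N')                    ∎
    where
    open ≡-Reasoning
    top-sum = sumFrom r 1 (suc s')
    bot-sum = sumFrom r (suc (suc s')) (suc N')
    top-sum≡bot-sum : top-sum ≡ bot-sum
    top-sum≡bot-sum = trans same-radius-sum (cong (sumFrom r (suc (suc s'))) (ℕ.m+n∸m≡n (suc s') (suc N')))

  module _ (r-pos : ∀ i → InRange n i → 0# < r i)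
           (top-centre : ∀ k → k ≤ℕ s' → p (top k) ≡ (r (top k) + A k , r (top k)))
           (bot-centre : ∀ l → l ≤ℕ N' → p (bot l) ≡ (r (bot l) + B l , - r (bot l)))
           (same-width : A (suc s') ≡ B (suc N')) where

    width-pos : ∀ {i} → InRange n i → 0# ≤ width i
    width-pos i∈ = inj₁ (+-pos (r-pos _ i∈) (r-pos _ i∈))

    overlap⇒adjacent : ∀ k l → k ≤ℕ s' → l ≤ℕ N' →
                       A k ≤ B (suc l) → B l ≤ A (suc k) → top k ~ bot l
    overlap⇒adjacent k l k≤s' l≤N' Aₖ≤Bₗ₊₁ Bₗ≤Aₖ₊₁ =
      top-in-range k≤s' , bot-in-range l≤N' ,
      facing-squares-EyEdge r p (top≢bot k≤s') (r-pos _ (top-in-range k≤s')) (r-pos _ (bot-in-range l≤N'))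
                            (top-centre k k≤s') (bot-centre l l≤N') Aₖ≤Bₗ₊₁ Bₗ≤Aₖ₊₁

    open Interleaving isTotalPreorder
    open TwoRows _~_ ~-sym top bot A B s' N'
                 (λ k k≤s' → x≤x+y (width-pos (top-in-range k≤s')))
                 (λ l l≤N' → x≤x+y (width-pos (bot-in-range l≤N')))
                 refl same-width overlap⇒adjacent

    reachable : ∀ i → InRange n i → Star _~_ (top 0) i
    reachable i i∈ with in-range⇒row i∈
    ... | inj₁ (k , k≤s' , refl) = top-reachable k k≤s'
    ... | inj₂ (l , l≤N' , refl) = bot-reachable l l≤N'

    connected : EyConnected n r p
    connected i j i∈ j∈ = reverse ~-sym (reachable i i∈) ◅◅ reachable j j∈

∃-suc-complement : ∀ {m n} → suc m ≤ℕ n ∸ 1 → ∃[ k ] n ≡ suc m +ℕ suc k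
∃-suc-complement {m} {suc n} 1+m≤n =
  n ∸ suc m , cong suc (sym (trans (ℕ.+-suc m (n ∸ suc m)) (ℕ.m+[n∸m]≡n 1+m≤n)))

lemma20 : (R : RealField) → let open RealField R in
    (n s : ℕ) (r : ℕ → ℝ) (p : ℕ → Point) →
    IsPacking n r p →
    1 ≤ℕ s → s ≤ℕ n ∸ 1 →
    sumFrom r 1 s ≡ sumFrom r (suc s) (n ∸ s) →
    p 1 ≡ (r 1 , r 1) →
    p (suc s) ≡ (r (suc s) , - r (suc s)) →
    (∀ i → 2 ≤ℕ i → i ≤ℕ s →
      p i ≡ (r i + sumFrom (λ j → r j + r j) 1 (i ∸ 1) , r i)) →
    (∀ i → s +ℕ 2 ≤ℕ i → i ≤ℕ n →
      p i ≡ (r i + sumFrom (λ j → r j + r j) (suc s) (i ∸ suc s) , - r i)) →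
    EyConnected n r p
lemma20 R n (suc s') r p (r-pos , _) (s≤s z≤n) s≤n∸1 same-radius-sum p₁ pₛ₊₁ top-centre bot-centre
  with ∃-suc-complement {n = n} s≤n∸1
... | N' , refl =
  connected r-pos (top-centres p₁ top-centre) (bot-centres pₛ₊₁ bot-centre) (equal-widths same-radius-sum)
  where open SquareRows R r p s' N'
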